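{- Let $m\ge 1$ and $\pi\in W_n^{ -1}(K_{1,m};132)$, and let $y_1,p_1,y_2,p_2,\dots,y_m,p_m,p^*$ be the non-accessory terms of $\pi$ in left-to-right order. Then for every $1\le i\le m$, no accessory term of $\pi$ lies (in position) strictly between $y_i$ and $p_i$.
   Context: For $\pi=\pi_1\cdots\pi_n\in\mathcal{S}_n$, the digraph $D(\pi)$ has vertices $1,\dots,n$ and an arc from $j$ to $i$ whenever $i<j$ and $\pi_i<\pi_j$. The weighted competition graph $W(\pi)$ is the edge-weighted simple graph on the same vertices in which distinct $u,v$ are joined by an edge iff they have a common out-neighbor in $D(\pi)$, with weight equal to the number of common out-neighbors. $K_{1,m}$ is the star with one center and $m$ leaves, all edge weights $1$. $W_n^{ -1}(K_{1,m};132)$ is the set of $132$-avoiding $\pi\in\mathcal{S}_n$ such that $W(\pi)$ is isomorphic, as an edge-weighted graph, to $K_{1,m}$ together with some number of isolated vertices. A term of $\pi$ is an accessory term if it is not part of any occurrence of the pattern $123$ or $132$ in $\pi$. For $\pi\in W_n^{ -1}(K_{1,m};132)$, the subsequence of non-accessory terms has $2m+1$ terms and is order-isomorphic to $(2m-1)(2m)(2m-3)(2m-2)\cdots 3\,4\,1\,2\,(2m+1)$; writing it as $y_1p_1y_2p_2\cdots y_mp_mp^*$, the pair $(y_i,p_i)$ is called the $i$-th $(YP)$-pair. -}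

module Defs where

open import Data.Nat using (ℕ; zero; suc; _*_)
open import Data.Fin using (Fin; _<_; _<?_; _≟_)
open import Data.Fin.Properties using (any?)
open import Data.Fin.Permutation using (Permutation′; _⟨$⟩ʳ_)
open import Data.Fin.Subset using (Subset; _∈_; _∉_; ∣_∣)
open import Data.List using (List; _∷_; length; filter; drop)
open import Data.List.Base using () renaming (allFin to allFinL)
open import Data.Product using (Σ; ∃; _×_; _,_)
open import Data.Sum using (_⊎_)
open import Relation.Nullary using (¬_; Dec)
open import Relation.Nullary.Decidable using (_×-dec_; _⊎-dec_)
open import Relation.Binary.PropositionalEquality using (_≡_; _≢_)

-- A permutation π of {1..n}; positions and values are both Fin n,
-- π i written  π ⟨$⟩ʳ i , compared via Data.Fin._<_ (on toℕ).
Perm : ℕ → Set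
Perm n = Permutation′ n

module _ {n : ℕ} (π : Perm n) where

  val : Fin n → Fin n
  val i = π ⟨$⟩ʳ i

  -- Arc j → i in D(π): i < j and π_i < π_j.
  Arc : Fin n → Fin n → Set
  Arc j i = (i < j) × (val i < val j)

  arc? : (j i : Fin n) → Dec (Arc j i)
  arc? j i = (i <? j) ×-dec (val i <? val j)

  weight : Fin n → Fin n → ℕ
  weight u v = length (filter (λ k → arc? u k ×-dec arc? v k) (allFinL n))

  Avoids132 : Set
  Avoids132 = ∀ (i j k : Fin n) → i < j → j < k →
              ¬ ((val i < val k) × (val k < val j))

  Occ123 : Fin n → Fin n → Fin n → Set
  Occ123 i j l = (i < j) × (j < l) × (val i < val j) × (val j < val l)

  Occ132 : Fin n → Fin n → Fin n → Set
  Occ132 i j l = (i < j) × (j < l) × (val i < val l) × (val l < val j)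

  occ123? : ∀ i j l → Dec (Occ123 i j l)
  occ123? i j l = (i <? j) ×-dec ((j <? l) ×-dec ((val i <? val j) ×-dec (val j <? val l)))

  occ132? : ∀ i j l → Dec (Occ132 i j l)
  occ132? i j l = (i <? j) ×-dec ((j <? l) ×-dec ((val i <? val l) ×-dec (val l <? val j)))

  NonAccessory : Fin n → Set
  NonAccessory k = ∃ λ i → ∃ λ j → ∃ λ l →
    (Occ123 i j l ⊎ Occ132 i j l) × (k ≡ i ⊎ k ≡ j ⊎ k ≡ l)

  nonAccessory? : ∀ k → Dec (NonAccessory k)
  nonAccessory? k = any? λ i → any? λ j → any? λ l →
    (occ123? i j l ⊎-dec occ132? i j l) ×-dec (k ≟ i ⊎-dec (k ≟ j ⊎-dec k ≟ l))

  Accessory : Fin n → Set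
  Accessory k = ¬ NonAccessory k

  nonAccessoryPositions : List (Fin n)
  nonAccessoryPositions = filter nonAccessory? (allFinL n)

  StarEdge : Fin n → Subset n → Fin n → Fin n → Set
  StarEdge c L u v = (u ≡ c × v ∈ L) ⊎ (v ≡ c × u ∈ L)

  -- W(π) ≅ K_{1,m} plus isolated vertices (as edge-weighted graphs):
  -- some centre c and m-element leaf set L ∌ c such that for distinct u, v
  -- the weight is 1 on star edges and 0 (no edge) otherwise.
  WIsStar : ℕ → Set
  WIsStar m = Σ (Fin n) λ c → Σ (Subset n) λ L →
    (∣ L ∣ ≡ m) × (c ∉ L) ×
    (∀ u v → u ≢ v →
       (StarEdge c L u v → weight u v ≡ 1) × (¬ StarEdge c L u v → weight u v ≡ 0))

InW⁻¹Star132 : (n m : ℕ) → Perm n → Set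
InW⁻¹Star132 n m π = Avoids132 π × WIsStar π m

module Submission where

-- Call a triple of positions w < u < v with π_w < π_u
-- and π_w < π_v a *triple* (bottom w, middle u, top v): it is exactly an
-- occurrence of 123 or 132, and w is then a common out-neighbour of u and v
-- in D(π).  If W(π) is a star (weights ≤ 1, every weighted pair contains
-- the centre) and π avoids 132, then
--   (A) the middle of a triple sits immediately after its bottom,
--   (B) no bottom of a triple is the middle of another triple,
--   (C) all triples share the same top, so the top is the rightmost
--       non-accessory position.
-- Hence in the sorted list of non-accessory positions every non-middle that
-- is not last is directly followed by its middle (a bottom, at distance 1),
-- and every middle is directly preceded by a non-middle.  A purely
-- list-theoretic induction (module Pairing) then shows that the entries at
-- even indices 2i are non-middles followed by an adjacent position, so the
-- i-th (YP)-pair occupies two consecutive positions and nothing lies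
-- strictly between them.

open import Defs
open import Data.Nat using (ℕ; _≤_; _<_; _*_)
open import Data.Fin using (Fin) renaming (_<_ to _<ꟳ_)
open import Data.List using (List; _∷_; drop)
open import Data.Product using (_×_)
open import Relation.Nullary using (¬_)
open import Relation.Binary.PropositionalEquality using (_≡_)

open import Data.Nat using (zero; suc; s≤s; z≤n)
import Data.Nat.Properties as ℕₚ
open import Data.Fin using (toℕ; fromℕ<; _≟_)
open import Data.Fin.Properties using (<-cmp; <-trans; <-irrefl; <⇒≢; toℕ-injective; toℕ-fromℕ<; toℕ<n)
open import Data.Fin.Subset using (Subset)
open import Data.Fin.Subset.Properties using (_∈?_)
open import Data.List using ([]; length; filter)
open import Data.List.Base using () renaming (allFin to allFinL)
open import Data.List.Membership.Propositional using () renaming (_∈_ to _∈ₗ_)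
open import Data.List.Membership.Propositional.Properties
  using (∈-filter⁺; ∈-filter⁻; ∈-allFin; ∈-length)
open import Data.List.Relation.Unary.Any using (here; there)
open import Data.List.Relation.Unary.All using (_∷_)
import Data.List.Relation.Unary.All as All
open import Data.List.Relation.Unary.AllPairs using (AllPairs; _∷_)
import Data.List.Relation.Unary.AllPairs.Properties as AllPairsₚ
open import Data.Product using (∃; _,_; proj₁; proj₂)
open import Data.Sum using (_⊎_; inj₁; inj₂)
open import Data.Empty using (⊥; ⊥-elim)
open import Function.Bundles using (Injection)
open import Function.Properties.Inverse using (↔⇒↣)
open import Relation.Nullary using (Dec; yes; no)
open import Relation.Nullary.Decidable using (_×-dec_; _⊎-dec_)
open import Relation.Binary using (Transitive; tri<; tri≈; tri>)
open import Relation.Binary.PropositionalEquality using (refl; sym; trans; cong; subst; _≢_)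

distinct∈⇒2≤length : ∀ {A : Set} {x y : A} {xs : List A} →
  x ∈ₗ xs → y ∈ₗ xs → x ≢ y → 2 ≤ length xs
distinct∈⇒2≤length (here refl) (here refl) x≢y = ⊥-elim (x≢y refl)
distinct∈⇒2≤length (here refl) (there y∈) _ = s≤s (∈-length y∈)
distinct∈⇒2≤length (there x∈) (here refl) _ = s≤s (∈-length x∈)
distinct∈⇒2≤length (there x∈) (there y∈) x≢y = ℕₚ.m≤n⇒m≤1+n (distinct∈⇒2≤length x∈ y∈ x≢y)

∈-drop : ∀ {A : Set} {y : A} d (xs : List A) → y ∈ₗ drop d xs → y ∈ₗ xs
∈-drop zero xs y∈ = y∈
∈-drop (suc d) [] y∈ = y∈
∈-drop (suc d) (x ∷ xs) y∈ = there (∈-drop d xs y∈)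

drop-suc⁻¹ : ∀ {A : Set} d (xs : List A) {y ys} →
  drop (suc d) xs ≡ y ∷ ys → ∃ λ a → drop d xs ≡ a ∷ y ∷ ys
drop-suc⁻¹ zero (a ∷ xs) eq = a , cong (a ∷_) eq
drop-suc⁻¹ (suc d) (x ∷ xs) eq = drop-suc⁻¹ d xs eq

module StrictlySorted {A : Set} {_≺_ : A → A → Set}
  (≺-trans : Transitive _≺_) (≺-irrefl : ∀ {x} → ¬ x ≺ x) where

  headLeast : ∀ {x xs z} → AllPairs _≺_ (x ∷ xs) → z ∈ₗ x ∷ xs → ¬ z ≺ x
  headLeast _ (here refl) z≺x = ≺-irrefl z≺x
  headLeast (x≺xs ∷ _) (there z∈) z≺x = ≺-irrefl (≺-trans z≺x (All.lookup x≺xs z∈))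

  consecutive : ∀ d {xs a b rest} → AllPairs _≺_ xs →
    drop d xs ≡ a ∷ b ∷ rest → a ≺ b
  consecutive d sorted eq with subst (AllPairs _≺_) eq (AllPairsₚ.drop⁺ d sorted)
  ... | (a≺b ∷ _) ∷ _ = a≺b

  nothingBetween : ∀ d xs {a b rest z} → AllPairs _≺_ xs →
    drop d xs ≡ a ∷ b ∷ rest → z ∈ₗ xs → a ≺ z → ¬ z ≺ b
  nothingBetween zero (a ∷ b ∷ rest) _ refl (here refl) a≺z _ = ≺-irrefl a≺z
  nothingBetween zero (a ∷ b ∷ rest) _ refl (there (here refl)) _ z≺b = ≺-irrefl z≺b
  nothingBetween zero (a ∷ b ∷ rest) (_ ∷ (b≺rest ∷ _)) refl (there (there z∈)) _ z≺b =
    ≺-irrefl (≺-trans z≺b (All.lookup b≺rest z∈))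
  nothingBetween (suc d) (x ∷ xs) (x≺xs ∷ _) eq (here refl) a≺x _ =
    ≺-irrefl (≺-trans a≺x (All.lookup x≺xs (∈-drop d xs (subst (_ ∈ₗ_) (sym eq) (here refl)))))
  nothingBetween (suc d) (x ∷ xs) (_ ∷ sorted) eq (there z∈) a≺z z≺b =
    nothingBetween d xs sorted eq z∈ a≺z z≺b

gapless⇒adjacent : ∀ {n} {w u : Fin n} → w <ꟳ u →
  (∀ t → w <ꟳ t → t <ꟳ u → ⊥) → toℕ u ≡ suc (toℕ w)
gapless⇒adjacent {w = w} {u} w<u gapless with toℕ u ℕₚ.≟ suc (toℕ w)
... | yes adjacent = adjacent
... | no notAdjacent = ⊥-elim (gapless t w<t t<u)
  where
  next<u : suc (toℕ w) < toℕ u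
  next<u = ℕₚ.≤∧≢⇒< w<u (λ e → notAdjacent (sym e))
  t : Fin _
  t = fromℕ< (ℕₚ.<-trans next<u (toℕ<n u))
  w<t : w <ꟳ t
  w<t = subst (toℕ w <_) (sym (toℕ-fromℕ< _)) ℕₚ.≤-refl
  t<u : t <ꟳ u
  t<u = subst (_< toℕ u) (sym (toℕ-fromℕ< _)) next<u

adjacent⇒gapless : ∀ {n} {y p k : Fin n} → toℕ p ≡ suc (toℕ y) → ¬ ((y <ꟳ k) × (k <ꟳ p))
adjacent⇒gapless {k = k} p≡y+1 (y<k , k<p) =
  ℕₚ.<⇒≱ y<k (ℕₚ.≤-pred (subst (toℕ k <_) p≡y+1 k<p))

noTriangleThrough : ∀ {A : Set} {c x y z : A} → x ≢ y → x ≢ z → y ≢ z →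
  (x ≡ c ⊎ y ≡ c) → (x ≡ c ⊎ z ≡ c) → (y ≡ c ⊎ z ≡ c) → ⊥
noTriangleThrough x≢y _ _ (inj₁ refl) (inj₁ _) (inj₁ refl) = x≢y refl
noTriangleThrough _ x≢z _ (inj₁ refl) (inj₁ _) (inj₂ refl) = x≢z refl
noTriangleThrough _ x≢z _ (inj₁ refl) (inj₂ refl) _ = x≢z refl
noTriangleThrough x≢y _ _ (inj₂ refl) (inj₁ refl) _ = x≢y refl
noTriangleThrough _ _ y≢z (inj₂ refl) (inj₂ refl) _ = y≢z refl

module SortedPositions {n : ℕ} (xs : List (Fin n)) (sorted : AllPairs _<ꟳ_ xs) where

  open StrictlySorted {_≺_ = _<ꟳ_ {n}} <-trans (<-irrefl refl) public

  neighbours∈ : ∀ d {a b rest} → drop d xs ≡ a ∷ b ∷ rest → a ∈ₗ xs × b ∈ₗ xs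
  neighbours∈ d eq = ∈-drop d xs (subst (_ ∈ₗ_) (sym eq) (here refl))
                   , ∈-drop d xs (subst (_ ∈ₗ_) (sym eq) (there (here refl)))

  successor-is-next : ∀ d {a b rest z} → drop d xs ≡ a ∷ b ∷ rest →
    z ∈ₗ xs → toℕ z ≡ suc (toℕ a) → z ≡ b
  successor-is-next d {a} {b} {z = z} eq z∈ z≡a+1 = toℕ-injective (ℕₚ.≤-antisym z≤b b≤z)
    where
    z≤b : toℕ z ≤ toℕ b
    z≤b = subst (_≤ toℕ b) (sym z≡a+1) (consecutive d sorted eq)
    b≤z : toℕ b ≤ toℕ z
    b≤z = ℕₚ.≮⇒≥ (nothingBetween d xs sorted eq z∈ (subst (toℕ a <_) (sym z≡a+1) ℕₚ.≤-refl))

  predecessor-is-prev : ∀ d {a b rest z} → drop d xs ≡ a ∷ b ∷ rest →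
    z ∈ₗ xs → toℕ b ≡ suc (toℕ z) → z ≡ a
  predecessor-is-prev d {a} {b} {z = z} eq z∈ b≡z+1 = toℕ-injective (ℕₚ.≤-antisym z≤a a≤z)
    where
    z≤a : toℕ z ≤ toℕ a
    z≤a = ℕₚ.≮⇒≥ (λ a<z → nothingBetween d xs sorted eq z∈ a<z (subst (toℕ z <_) (sym b≡z+1) ℕₚ.≤-refl))
    a≤z : toℕ a ≤ toℕ z
    a≤z = ℕₚ.≤-pred (subst (toℕ a <_) b≡z+1 (consecutive d sorted eq))

module Pairing {n : ℕ} (xs : List (Fin n)) (sorted : AllPairs _<ꟳ_ xs)
  (Mid : Fin n → Set)
  (nonMid-next : ∀ {a b} → a ∈ₗ xs → b ∈ₗ xs → a <ꟳ b → ¬ Mid a →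
                 ∃ λ a′ → a′ ∈ₗ xs × Mid a′ × toℕ a′ ≡ suc (toℕ a))
  (mid-prev : ∀ {x} → Mid x → ∃ λ w → w ∈ₗ xs × ¬ Mid w × toℕ x ≡ suc (toℕ w)) where

  open SortedPositions xs sorted

  pairStep : ∀ d {a b rest} → drop d xs ≡ a ∷ b ∷ rest → ¬ Mid a →
    toℕ b ≡ suc (toℕ a) × Mid b
  pairStep d eq ¬mid-a
    with nonMid-next (proj₁ (neighbours∈ d eq)) (proj₂ (neighbours∈ d eq)) (consecutive d sorted eq) ¬mid-a
  ... | a′ , a′∈ , mid-a′ , a′≡a+1 with successor-is-next d eq a′∈ a′≡a+1
  ... | refl = a′≡a+1 , mid-a′

  -- The entries at even indices are non-middles: the head has nothing to its
  -- left, and at index 2i+2 the adjacent predecessor would be the middle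
  -- found at index 2i+1.
  evenNotMid : ∀ i {x rest} → drop (2 * i) xs ≡ x ∷ rest → ¬ Mid x
  evenNotMid zero eq mid-x with mid-prev mid-x
  ... | w , w∈ , _ , x≡w+1 =
    headLeast (subst (AllPairs _<ꟳ_) eq sorted) (subst (w ∈ₗ_) eq w∈)
      (subst (toℕ w <_) (sym x≡w+1) ℕₚ.≤-refl)
  evenNotMid (suc i) {x} {rest} eq mid-x
    with drop-suc⁻¹ (suc (2 * i)) xs (subst (λ d → drop d xs ≡ x ∷ rest) (ℕₚ.*-suc 2 i) eq)
  ... | _ , b∷x≡ with drop-suc⁻¹ (2 * i) xs b∷x≡ | mid-prev mid-x
  ... | _ , a∷b∷x≡ | w , w∈ , ¬mid-w , x≡w+1 with predecessor-is-prev (suc (2 * i)) b∷x≡ w∈ x≡w+1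
  ... | refl = ¬mid-w (proj₂ (pairStep (2 * i) a∷b∷x≡ (evenNotMid i a∷b∷x≡)))

  pairsAdjacent : ∀ i {y p rest} → drop (2 * i) xs ≡ y ∷ p ∷ rest → toℕ p ≡ suc (toℕ y)
  pairsAdjacent i eq = proj₁ (pairStep (2 * i) eq (evenNotMid i eq))

module StarCompetition {n : ℕ} (π : Perm n) (avoids : Avoids132 π) (c : Fin n) (L : Subset n)
  (star : ∀ u v → u ≢ v →
    (StarEdge π c L u v → weight π u v ≡ 1) × (¬ StarEdge π c L u v → weight π u v ≡ 0)) where

  val-injective : ∀ {i j} → val π i ≡ val π j → i ≡ j
  val-injective = Injection.injective (↔⇒↣ π)

  CommonOut : Fin n → Fin n → Fin n → Set
  CommonOut k u v = Arc π u k × Arc π v k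

  common∈ : ∀ {k u v} → CommonOut k u v →
    k ∈ₗ filter (λ k → arc? π u k ×-dec arc? π v k) (allFinL n)
  common∈ {k} {u} {v} = ∈-filter⁺ (λ k → arc? π u k ×-dec arc? π v k) (∈-allFin k)

  starEdge? : ∀ u v → Dec (StarEdge π c L u v)
  starEdge? u v = ((u ≟ c) ×-dec (v ∈? L)) ⊎-dec ((v ≟ c) ×-dec (u ∈? L))

  weight≤1 : ∀ {u v} → u ≢ v → weight π u v ≤ 1
  weight≤1 {u} {v} u≢v with starEdge? u v
  ... | yes edge = ℕₚ.≤-reflexive (proj₁ (star u v u≢v) edge)
  ... | no ¬edge = subst (_≤ 1) (sym (proj₂ (star u v u≢v) ¬edge)) z≤n

  common-unique : ∀ {k k′ u v} → CommonOut k u v → CommonOut k′ u v → u ≢ v → k ≡ k′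
  common-unique {k} {k′} common common′ u≢v with k ≟ k′
  ... | yes k≡k′ = k≡k′
  ... | no k≢k′ = ⊥-elim (ℕₚ.<-irrefl refl
          (ℕₚ.≤-trans (distinct∈⇒2≤length (common∈ common) (common∈ common′) k≢k′) (weight≤1 u≢v)))

  common⇒centre : ∀ {k u v} → CommonOut k u v → u ≢ v → u ≡ c ⊎ v ≡ c
  common⇒centre {u = u} {v} common u≢v with starEdge? u v
  ... | yes (inj₁ (u≡c , _)) = inj₁ u≡c
  ... | yes (inj₂ (v≡c , _)) = inj₂ v≡c
  ... | no ¬edge = ⊥-elim (ℕₚ.n≮0 (subst (0 <_) (proj₂ (star u v u≢v) ¬edge) (∈-length (common∈ common))))

  Triple : Fin n → Fin n → Fin n → Set
  Triple w u v = (u <ꟳ v) × CommonOut w u v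

  occurrence⇒triple : ∀ {i j l} → Occ123 π i j l ⊎ Occ132 π i j l → Triple i j l
  occurrence⇒triple (inj₁ (i<j , j<l , πi<πj , πj<πl)) =
    j<l , (i<j , πi<πj) , (<-trans i<j j<l , ℕₚ.<-trans πi<πj πj<πl)
  occurrence⇒triple (inj₂ (i<j , j<l , πi<πl , πl<πj)) =
    j<l , (i<j , ℕₚ.<-trans πi<πl πl<πj) , (<-trans i<j j<l , πi<πl)

  triple⇒occurrence : ∀ {w u v} → Triple w u v → Occ123 π w u v ⊎ Occ132 π w u v
  triple⇒occurrence {u = u} {v} (u<v , (w<u , πw<πu) , (_ , πw<πv)) with <-cmp (val π u) (val π v)
  ... | tri< πu<πv _ _ = inj₁ (w<u , u<v , πw<πu , πu<πv)
  ... | tri≈ _ πu≡πv _ = ⊥-elim (<-irrefl (val-injective πu≡πv) u<v)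
  ... | tri> _ _ πv<πu = inj₂ (w<u , u<v , πw<πv , πv<πu)

  InTriple : Fin n → Set
  InTriple z = ∃ λ w → ∃ λ u → ∃ λ v → Triple w u v × (z ≡ w ⊎ z ≡ u ⊎ z ≡ v)

  nonAccessory⇒inTriple : ∀ {z} → NonAccessory π z → InTriple z
  nonAccessory⇒inTriple (i , j , l , occurrence , z∈) = i , j , l , occurrence⇒triple occurrence , z∈

  inTriple⇒nonAccessory : ∀ {z} → InTriple z → NonAccessory π z
  inTriple⇒nonAccessory (w , u , v , triple , z∈) = w , u , v , triple⇒occurrence triple , z∈

  -- (A) Nothing lies strictly between the bottom and the middle of a triple:
  -- such a t would either form a triangle with u and v in the star
  -- (π_t > π_w) or be a second common out-neighbour of u and v (π_t < π_w).
  bottom-middle-gapless : ∀ {w u v} → Triple w u v → ∀ t → w <ꟳ t → t <ꟳ u → ⊥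
  bottom-middle-gapless {w} {u} {v} (u<v , common@((w<u , πw<πu) , (w<v , πw<πv))) t w<t t<u
    with <-cmp (val π w) (val π t)
  ... | tri< πw<πt _ _ =
    noTriangleThrough (<⇒≢ t<u) (<⇒≢ t<v) (<⇒≢ u<v)
      (common⇒centre ((w<t , πw<πt) , (w<u , πw<πu)) (<⇒≢ t<u))
      (common⇒centre ((w<t , πw<πt) , (w<v , πw<πv)) (<⇒≢ t<v))
      (common⇒centre common (<⇒≢ u<v))
    where t<v = <-trans t<u u<v
  ... | tri≈ _ πw≡πt _ = <-irrefl (val-injective πw≡πt) w<t
  ... | tri> _ _ πt<πw = <-irrefl (sym t≡w) w<t
    where
    t≡w : t ≡ w
    t≡w = common-unique ((t<u , ℕₚ.<-trans πt<πw πw<πu) , (<-trans t<u u<v , ℕₚ.<-trans πt<πw πw<πv))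
                        common (<⇒≢ u<v)

  middle-adjacent : ∀ {w u v} → Triple w u v → toℕ u ≡ suc (toℕ w)
  middle-adjacent triple@(_ , (w<u , _) , _) = gapless⇒adjacent w<u (bottom-middle-gapless triple)

  -- (B) The bottom of a triple is never the middle of another triple: the
  -- other bottom would be a second common out-neighbour of u and v.
  bottom-not-middle : ∀ {w′ w v′ u v} → Triple w′ w v′ → Triple w u v → ⊥
  bottom-not-middle (_ , (w′<w , πw′<πw) , _) (u<v , common@((w<u , πw<πu) , (w<v , πw<πv))) =
    <-irrefl (common-unique common′ common (<⇒≢ u<v)) w′<w
    where
    common′ : CommonOut _ _ _
    common′ = (<-trans w′<w w<u , ℕₚ.<-trans πw′<πw πw<πu) , (<-trans w′<w w<v , ℕₚ.<-trans πw′<πw πw<πv)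

  -- Every bottom is an out-neighbour of the centre, which is its middle or top.
  bottom-below-centre : ∀ {w u v} → Triple w u v → Arc π c w
  bottom-below-centre (u<v , common@(arc-u , arc-v)) with common⇒centre common (<⇒≢ u<v)
  ... | inj₁ refl = arc-u
  ... | inj₂ refl = arc-v

  -- If the centre is the middle of a triple, 132-avoidance puts the value of
  -- its top above the value of the centre ...
  centre-below-top : ∀ {w v} → Triple w c v → val π c <ꟳ val π v
  centre-below-top {w} {v} (c<v , (w<c , _) , (_ , πw<πv)) with <-cmp (val π c) (val π v)
  ... | tri< πc<πv _ _ = πc<πv
  ... | tri≈ _ πc≡πv _ = ⊥-elim (<-irrefl (val-injective πc≡πv) c<v)
  ... | tri> _ _ πv<πc = ⊥-elim (avoids w c v w<c c<v (πw<πv , πv<πc))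

  bottom-below-top : ∀ {w v w₁ u₁ v₁} → Triple w c v → Triple w₁ u₁ v₁ → Arc π v w₁
  bottom-below-top t@(c<v , _) t₁ with bottom-below-centre t₁
  ... | w₁<c , πw₁<πc = <-trans w₁<c c<v , ℕₚ.<-trans πw₁<πc (centre-below-top t)

  -- (C) If the centre is the middle of a triple, then its top v is the top
  -- of every triple: the bottom w₁ of another triple is a common
  -- out-neighbour of v and v₁, and of u₁ and v, and the star allows both
  -- only when v = v₁.
  centre-middle-top : ∀ {w v w₁ u₁ v₁} → Triple w c v → Triple w₁ u₁ v₁ → v ≡ v₁
  centre-middle-top {v = v} {v₁ = v₁} t@(c<v , _) t₁@(u₁<v₁ , arc-u₁ , arc-v₁) with v ≟ v₁
  ... | yes v≡v₁ = v≡v₁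
  ... | no v≢v₁ with common⇒centre (bottom-below-top t t₁ , arc-v₁) v≢v₁
  ...   | inj₁ v≡c = ⊥-elim (<-irrefl (sym v≡c) c<v)
  ...   | inj₂ refl with common⇒centre (arc-u₁ , bottom-below-top t t₁) (<⇒≢ (<-trans u₁<v₁ c<v))
  ...     | inj₁ refl = ⊥-elim (<-irrefl refl u₁<v₁)
  ...     | inj₂ v≡c = ⊥-elim (<-irrefl (sym v≡c) c<v)

  top-unique : ∀ {w u v w₁ u₁ v₁} → Triple w u v → Triple w₁ u₁ v₁ → v ≡ v₁
  top-unique t@(u<v , common) t₁@(u₁<v₁ , common₁)
    with common⇒centre common (<⇒≢ u<v) | common⇒centre common₁ (<⇒≢ u₁<v₁)
  ... | inj₁ refl | _ = centre-middle-top t t₁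
  ... | inj₂ refl | inj₁ refl = sym (centre-middle-top t₁ t)
  ... | inj₂ refl | inj₂ refl = refl

  top-maximal : ∀ {z w u v} → InTriple z → Triple w u v → toℕ z ≤ toℕ v
  top-maximal (w₁ , u₁ , v₁ , t₁@(u₁<v₁ , (w₁<u₁ , _) , _) , z∈) t rewrite top-unique t t₁ with z∈
  ... | inj₁ refl = ℕₚ.<⇒≤ (<-trans w₁<u₁ u₁<v₁)
  ... | inj₂ (inj₁ refl) = ℕₚ.<⇒≤ u₁<v₁
  ... | inj₂ (inj₂ refl) = ℕₚ.≤-refl

  NL : List (Fin n)
  NL = nonAccessoryPositions π

  NL-sorted : AllPairs _<ꟳ_ NL
  NL-sorted = AllPairsₚ.filter⁺ (nonAccessory? π) (AllPairsₚ.tabulate⁺-< (λ i<j → i<j))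

  ∈NL⇒inTriple : ∀ {z} → z ∈ₗ NL → InTriple z
  ∈NL⇒inTriple z∈ = nonAccessory⇒inTriple (proj₂ (∈-filter⁻ (nonAccessory? π) {xs = allFinL n} z∈))

  inTriple⇒∈NL : ∀ {z} → InTriple z → z ∈ₗ NL
  inTriple⇒∈NL {z} inTriple = ∈-filter⁺ (nonAccessory? π) (∈-allFin z) (inTriple⇒nonAccessory inTriple)

  Middle : Fin n → Set
  Middle u = ∃ λ w → ∃ λ v → Triple w u v

  -- A non-accessory non-middle a that is not rightmost is a bottom (by (C)),
  -- so its middle sits at position a+1 (by (A)).
  nonMiddle-next : ∀ {a b} → a ∈ₗ NL → b ∈ₗ NL → a <ꟳ b → ¬ Middle a →
    ∃ λ a′ → a′ ∈ₗ NL × Middle a′ × toℕ a′ ≡ suc (toℕ a)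
  nonMiddle-next a∈ b∈ a<b ¬middle with ∈NL⇒inTriple a∈
  ... | w , u , v , t , inj₁ refl =
    u , inTriple⇒∈NL (w , u , v , t , inj₂ (inj₁ refl)) , (w , v , t) , middle-adjacent t
  ... | w , u , v , t , inj₂ (inj₁ refl) = ⊥-elim (¬middle (w , v , t))
  ... | w , u , v , t , inj₂ (inj₂ refl) = ⊥-elim (ℕₚ.<⇒≱ a<b (top-maximal (∈NL⇒inTriple b∈) t))

  -- A middle is preceded at distance one by its bottom, a non-middle by (A), (B).
  middle-prev : ∀ {x} → Middle x → ∃ λ w → w ∈ₗ NL × ¬ Middle w × toℕ x ≡ suc (toℕ w)
  middle-prev {x} (w , v , t) =
    w , inTriple⇒∈NL (w , x , v , t , inj₁ refl) ,
    (λ { (_ , _ , t′) → bottom-not-middle t′ t }) , middle-adjacent t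

  open Pairing NL NL-sorted Middle nonMiddle-next middle-prev public using (pairsAdjacent)

mainTheorem12 : (n m : ℕ) → 1 ≤ m → (π : Perm n) → InW⁻¹Star132 n m π →
    ∀ (i : ℕ) → i < m →
    ∀ (y p : Fin n) (rest : List (Fin n)) →
      drop (2 * i) (nonAccessoryPositions π) ≡ y ∷ p ∷ rest →
      ∀ (k : Fin n) → Accessory π k → ¬ ((y <ꟳ k) × (k <ꟳ p))
mainTheorem12 n m _ π (avoids , c , L , _ , _ , star) i _ y p rest pair k _ =
  adjacent⇒gapless (StarCompetition.pairsAdjacent π avoids c L star i pair)
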